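{- Let $G_1,G_2,G_3$ be pairwise vertex-disjoint connected graphs with $|V(G_i)|=n_i\ge 2$ and $|E(G_i)|=m_i$, and let $u_i\in V(G_i)$ for $i=1,2,3$. Let $v$ be a vertex of $G_1$ at maximum distance from $u_1$ in $G_1$. Let $G_0$ be obtained from $G_1$ and $G_2$ by identifying $u_1$ with $u_2$ into a new vertex $u$. Let $G$ (resp. $G'$) be obtained from $G_0$ and $G_3$ by identifying $u_3$ with $u$ (resp. with $v$). If $m_2\ge m_1$, then $W_e(G)\le W_e(G')$.
   Context: For a connected graph $G$ and edges $f=u_1u_2$, $g=v_1v_2$, $d_G(f,g)=\min\{d_G(u_i,v_j): i,j\in\{1,2\}\}+1$ if $f\neq g$, and $d_G(f,f)=0$; $W_e(G)=\sum_{\{f,g\}\subseteq E(G)} d_G(f,g)$ over unordered pairs of edges. -}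

module Defs where

open import Data.Bool using (Bool; true; false; _∧_; _∨_; if_then_else_)
open import Data.Nat using (ℕ; zero; suc; _+_; _<ᵇ_; _⊓_)
open import Data.Fin using (Fin; toℕ; splitAt; _↑ˡ_; _↑ʳ_; punchIn; punchOut)
open import Data.Fin.Properties using (_≟_)
open import Data.List using (List; []; _∷_; map; _++_; concatMap; filterᵇ; length; allFin)
open import Data.Bool.ListAction using (any)
open import Data.Nat.ListAction using (sum)
open import Data.Product using (_×_; _,_)
open import Data.Sum using (inj₁; inj₂)
open import Relation.Nullary using (¬_; yes; no)
open import Relation.Nullary.Decidable using (⌊_⌋)
open import Relation.Binary.PropositionalEquality using (_≡_)

Graph : ℕ → Set
Graph n = Fin n → Fin n → Bool

record IsSimple {n : ℕ} (G : Graph n) : Set where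
  field
    symmetric   : ∀ x y → G x y ≡ G y x
    irreflexive : ∀ x → G x x ≡ false

data Walk {n : ℕ} (G : Graph n) : Fin n → Fin n → Set where
  here : ∀ {x} → Walk G x x
  step : ∀ {x y z} → G x y ≡ true → Walk G y z → Walk G x z

Connected : {n : ℕ} → Graph n → Set
Connected {n} G = ∀ (x y : Fin n) → Walk G x y

reachWithin : {n : ℕ} → Graph n → ℕ → Fin n → Fin n → Bool
reachWithin G zero x y = ⌊ x ≟ y ⌋
reachWithin {n} G (suc k) x y =
  reachWithin G k x y ∨ any (λ z → reachWithin G k x z ∧ G z y) (allFin n)

-- distance: least k (searching k = 0 .. n) with a walk of length ≤ k
-- (for connected graphs it is the usual shortest-path distance)
distAux : {n : ℕ} → Graph n → Fin n → Fin n → ℕ → ℕ → ℕ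
distAux G x y zero k = k
distAux G x y (suc f) k =
  if reachWithin G k x y then k else distAux G x y f (suc k)

dist : {n : ℕ} → Graph n → Fin n → Fin n → ℕ
dist {n} G x y = distAux G x y n 0

Edge : ℕ → Set
Edge n = Fin n × Fin n

edges : {n : ℕ} → Graph n → List (Edge n)
edges {n} G =
  concatMap (λ i → map (λ j → (i , j))
                       (filterᵇ (λ j → (toℕ i <ᵇ toℕ j) ∧ G i j) (allFin n)))
            (allFin n)

numEdges : {n : ℕ} → Graph n → ℕ
numEdges G = length (edges G)

edgeDist : {n : ℕ} → Graph n → Edge n → Edge n → ℕ
edgeDist G (u₁ , u₂) (v₁ , v₂) =
  suc ((dist G u₁ v₁ ⊓ dist G u₁ v₂) ⊓ (dist G u₂ v₁ ⊓ dist G u₂ v₂))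

pairsOf : {A : Set} → List A → List (A × A)
pairsOf [] = []
pairsOf (x ∷ xs) = map (λ y → (x , y)) xs ++ pairsOf xs

-- edge Wiener index (edges in the list are pairwise distinct)
We : {n : ℕ} → Graph n → ℕ
We G = sum (map (λ p → edgeDist G (Data.Product.proj₁ p) (Data.Product.proj₂ p))
                (pairsOf (edges G)))

-- Result has vertex set Fin (a + b):
-- the first a vertices are G's, the last b are H's vertices other than y
-- (vertex j ↦ punchIn y j).  The identified vertex is x ↑ˡ b.
glue : {a b : ℕ} → Graph a → Fin a → Graph (suc b) → Fin (suc b) → Graph (a + b)
glue {a} {b} G x H y p q with splitAt a p | splitAt a q
... | inj₁ i | inj₁ i′ = G i i′
... | inj₁ i | inj₂ j  = ⌊ i ≟ x ⌋ ∧ H y (punchIn y j)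
... | inj₂ j | inj₁ i  = ⌊ i ≟ x ⌋ ∧ H (punchIn y j) y
... | inj₂ j | inj₂ j′ = H (punchIn y j) (punchIn y j′)

embL : {a : ℕ} (b : ℕ) → Fin a → Fin (a + b)
embL b x = x ↑ˡ b

module Submission where

-- Glue a graph Y at its vertex y onto a vertex c of a graph X.  Distances add up across the cut
-- vertex, so a pair of edges e of X and f of Y is at distance 1 + d_X(c, e) + d_Y(y, f), where
-- d(c, e) is the distance from c to the nearer endpoint of e.  Splitting the pairs of edges into
-- pairs inside X, pairs inside Y and mixed pairs therefore gives
--   W_e = W_e(X) + C + |E(Y)| · D_X(c),   D_X(c) = Σ_{e ∈ E(X)} d_X(c, e),
-- with C independent of c.  For X = G₀ it remains to show D(u) ≤ D(v).  Moving the root from u to v,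
-- at distance Δ from u₁ in G₁, raises d(c, e) by exactly Δ for each of the m₂ edges of G₂ and lowers
-- it by at most Δ for each of the m₁ edges of G₁; as m₁ ≤ m₂, D(u) ≤ D(v).

open import Defs
open import Data.Bool using (Bool; true; false; not; T; _∧_)
open import Data.Bool.Properties using (T?; T-∨; T-∧; T-≡; ∧-identityʳ; ∧-zeroʳ)
open import Data.Fin as Fin using (Fin; zero; suc; toℕ; splitAt; join; _↑ˡ_; _↑ʳ_; punchIn; punchOut)
import Data.Fin.Properties as Finₚ
open import Data.Fin.Properties
  using (_≟_; pigeonhole; splitAt-↑ˡ; splitAt-↑ʳ; splitAt-join; join-splitAt; toℕ-↑ˡ; toℕ-↑ʳ; toℕ<n;
         punchInᵢ≢i; punchIn-punchOut; punchOut-punchIn; punchOut-cong)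
open import Data.List using (List; []; _∷_; map; _++_; filterᵇ; length; concatMap; lookup; allFin; tabulate)
open import Data.List.Properties
  using (length-map; length-++; map-++; map-cong; map-cong-local; map-∘; map-id; map-tabulate; ++-identityʳ;
         filter-≐; filter-none; filter-++; concatMap-++; concatMap-map; concatMap-cong; map-concatMap)
open import Data.List.Membership.Propositional using (_∈_; lose)
open import Data.List.Membership.Propositional.Properties using (∈-lookup; ∈-allFin)
import Data.List.Membership.DecPropositional as DecMembership
open import Data.List.Relation.Unary.All as All using (All; []; _∷_)
open import Data.List.Relation.Unary.All.Properties using (¬Any⇒All¬; concat⁺; map⁺; all-filter; filter⁺)
open import Data.List.Relation.Unary.AllPairs using ([]; _∷_)
open import Data.List.Relation.Unary.Any as Any using (here; there)
open import Data.List.Relation.Unary.Any.Properties using (any⁺; any⁻)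
open import Data.List.Relation.Unary.Unique.Propositional using (Unique)
open import Data.Nat using (ℕ; zero; suc; _+_; _*_; _≤_; _<_; z≤n; s≤s; _≤?_; _<ᵇ_; _⊓_)
open import Data.Nat.ListAction using (sum)
open import Data.Nat.ListAction.Properties using (sum-++)
open import Data.Nat.Properties
  using (+-assoc; +-comm; +-suc; +-identityʳ; *-comm; *-zeroʳ; *-distribˡ-+; *-cancelʳ-≡;
         +-distribˡ-⊓; +-distribʳ-⊓; suc-injective; n≤0⇒n≡0;
         ≤-refl; ≤-trans; ≤-antisym; ≤-reflexive; ≰⇒>; ≤∧≢⇒<; ≤⇒≯; <⇒≤; m≤n⇒m≤1+n; m≤m+n; m≤n+m; <⇒<ᵇ; <ᵇ⇒<;
         +-mono-≤; +-monoˡ-≤; +-monoʳ-≤; *-monoˡ-≤; *-monoʳ-≤; ⊓-mono-≤;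
         +-commutativeSemigroup; +-0-commutativeMonoid; ⊓-commutativeSemigroup; module ≤-Reasoning)
open import Data.Nat.Tactic.RingSolver using (solve-∀)
open import Algebra.Properties.CommutativeMonoid.Sum +-0-commutativeMonoid
  using (sum-syntax; ∑-distrib-+; ∑-comm; sum-remove; sum-cong-≗)
open import Algebra.Properties.CommutativeSemigroup +-commutativeSemigroup
  using (x∙yz≈y∙xz; xy∙z≈y∙xz) renaming (interchange to +-interchange)
open import Algebra.Properties.CommutativeSemigroup ⊓-commutativeSemigroup
  using () renaming (interchange to ⊓-interchange)
import Data.Product as Product
open import Data.Product using (Σ; _×_; _,_; proj₁; proj₂)
open import Data.Sum using (_⊎_; inj₁; inj₂; [_,_]′)
open import Data.Unit using (tt)
open import Function using (_∘_; id; const; Equivalence)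
open import Relation.Binary using (tri<; tri≈; tri>)
open import Relation.Binary.PropositionalEquality
open import Relation.Nullary using (yes; no; contradiction)
open import Relation.Nullary.Decidable using (⌊_⌋; dec-true; dec-false; isYes≗does)

private variable
  A B : Set

sumMap : (A → ℕ) → List A → ℕ
sumMap f xs = sum (map f xs)

sumMap-++ : (f : A → ℕ) (xs ys : List A) → sumMap f (xs ++ ys) ≡ sumMap f xs + sumMap f ys
sumMap-++ f xs ys = trans (cong sum (map-++ f xs ys)) (sum-++ (map f xs) (map f ys))

sumMap-cong : {f g : A → ℕ} → (∀ x → f x ≡ g x) → ∀ xs → sumMap f xs ≡ sumMap g xs
sumMap-cong f≗g xs = cong sum (map-cong f≗g xs)

sumMap-cong-local : {P : A → Set} {f g : A → ℕ} → (∀ {x} → P x → f x ≡ g x) →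
                    ∀ {xs} → All P xs → sumMap f xs ≡ sumMap g xs
sumMap-cong-local f≗g ps = cong sum (map-cong-local (All.map f≗g ps))

sumMap-map : (f : B → ℕ) (g : A → B) (xs : List A) → sumMap f (map g xs) ≡ sumMap (f ∘ g) xs
sumMap-map f g xs = cong sum (sym (map-∘ xs))

sumMap-mono-≤ : {f g : A → ℕ} → (∀ x → f x ≤ g x) → ∀ xs → sumMap f xs ≤ sumMap g xs
sumMap-mono-≤ f≤g []       = z≤n
sumMap-mono-≤ f≤g (x ∷ xs) = +-mono-≤ (f≤g x) (sumMap-mono-≤ f≤g xs)

sumMap-+ : (f g : A → ℕ) (xs : List A) → sumMap (λ x → f x + g x) xs ≡ sumMap f xs + sumMap g xs
sumMap-+ f g []       = refl
sumMap-+ f g (x ∷ xs) = trans (cong (f x + g x +_) (sumMap-+ f g xs))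
                              (+-interchange (f x) (g x) (sumMap f xs) (sumMap g xs))

sumMap-const : (c : ℕ) (xs : List A) → sumMap (λ _ → c) xs ≡ length xs * c
sumMap-const c []       = refl
sumMap-const c (x ∷ xs) = cong (c +_) (sumMap-const c xs)

sumMap-+ˡ-const : (c : ℕ) (f : A → ℕ) (xs : List A) → sumMap (λ x → c + f x) xs ≡ length xs * c + sumMap f xs
sumMap-+ˡ-const c f xs = trans (sumMap-+ (λ _ → c) f xs) (cong (_+ sumMap f xs) (sumMap-const c xs))

sumMap-*ˡ : (k : ℕ) (f : A → ℕ) (xs : List A) → sumMap (λ x → k * f x) xs ≡ k * sumMap f xs
sumMap-*ˡ k f []       = sym (*-zeroʳ k)
sumMap-*ˡ k f (x ∷ xs) = trans (cong (k * f x +_) (sumMap-*ˡ k f xs)) (sym (*-distribˡ-+ k (f x) (sumMap f xs)))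

filterᵇ-cong : {p q : A → Bool} → (∀ x → p x ≡ q x) → ∀ xs → filterᵇ p xs ≡ filterᵇ q xs
filterᵇ-cong {p = p} {q} p≗q = filter-≐ (T? ∘ p) (T? ∘ q) (subst T (p≗q _) , subst T (sym (p≗q _)))

filterᵇ-none : (p : A → Bool) → (∀ x → p x ≡ false) → ∀ xs → filterᵇ p xs ≡ []
filterᵇ-none p p≡false xs = filter-none (T? ∘ p) (All.universal (λ x → subst T (p≡false x)) xs)

filterᵇ-false : (xs : List A) → filterᵇ (const false) xs ≡ []
filterᵇ-false = filterᵇ-none (const false) (λ _ → refl)

filterᵇ-map : (q : B → Bool) (g : A → B) (xs : List A) → filterᵇ q (map g xs) ≡ map g (filterᵇ (q ∘ g) xs)
filterᵇ-map q g [] = refl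
filterᵇ-map q g (x ∷ xs) with q (g x)
... | true  = cong (g x ∷_) (filterᵇ-map q g xs)
... | false = filterᵇ-map q g xs

filterᵇ-filterᵇ : (p q : A → Bool) (xs : List A) → filterᵇ q (filterᵇ p xs) ≡ filterᵇ (λ x → p x ∧ q x) xs
filterᵇ-filterᵇ p q [] = refl
filterᵇ-filterᵇ p q (x ∷ xs) with p x
... | false = filterᵇ-filterᵇ p q xs
... | true with q x
...   | true  = cong (x ∷_) (filterᵇ-filterᵇ p q xs)
...   | false = filterᵇ-filterᵇ p q xs

filterᵇ-concatMap : (q : B → Bool) (f : A → List B) (xs : List A) →
                    filterᵇ q (concatMap f xs) ≡ concatMap (filterᵇ q ∘ f) xs
filterᵇ-concatMap q f []       = refl
filterᵇ-concatMap q f (x ∷ xs) =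
  trans (filter-++ (T? ∘ q) (f x) (concatMap f xs)) (cong (filterᵇ q (f x) ++_) (filterᵇ-concatMap q f xs))

𝟙 : Bool → ℕ
𝟙 true  = 1
𝟙 false = 0

length-filterᵇ : (p : A → Bool) (xs : List A) → length (filterᵇ p xs) ≡ sumMap (𝟙 ∘ p) xs
length-filterᵇ p [] = refl
length-filterᵇ p (x ∷ xs) with p x
... | true  = cong suc (length-filterᵇ p xs)
... | false = length-filterᵇ p xs

length-concatMap : (f : A → List B) (xs : List A) → length (concatMap f xs) ≡ sumMap (length ∘ f) xs
length-concatMap f []       = refl
length-concatMap f (x ∷ xs) = trans (length-++ (f x)) (cong (length (f x) +_) (length-concatMap f xs))

sumMap-partition : (f : A → ℕ) (p : A → Bool) (xs : List A) →
                   sumMap f xs ≡ sumMap f (filterᵇ p xs) + sumMap f (filterᵇ (not ∘ p) xs)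
sumMap-partition f p [] = refl
sumMap-partition f p (x ∷ xs) with p x
... | true  =
  trans (cong (f x +_) (sumMap-partition f p xs)) (sym (+-assoc (f x) (sumMap f (filterᵇ p xs)) _))
... | false =
  trans (cong (f x +_) (sumMap-partition f p xs))
        (x∙yz≈y∙xz (f x) (sumMap f (filterᵇ p xs)) (sumMap f (filterᵇ (not ∘ p) xs)))

pairSum : (A → A → ℕ) → List A → ℕ
pairSum F xs = sumMap (λ p → F (proj₁ p) (proj₂ p)) (pairsOf xs)

crossSum : (A → B → ℕ) → List A → List B → ℕ
crossSum F xs ys = sumMap (λ x → sumMap (F x) ys) xs

pairSum-∷ : (F : A → A → ℕ) (x : A) (xs : List A) → pairSum F (x ∷ xs) ≡ sumMap (F x) xs + pairSum F xs
pairSum-∷ F x xs = trans (sumMap-++ _ (map (x ,_) xs) (pairsOf xs))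
                         (cong (_+ pairSum F xs) (sumMap-map _ (x ,_) xs))

crossSum-∷ʳ : (F : A → B → ℕ) (xs : List A) (y : B) (ys : List B) →
              crossSum F xs (y ∷ ys) ≡ sumMap (λ x → F x y) xs + crossSum F xs ys
crossSum-∷ʳ F xs y ys = sumMap-+ (λ x → F x y) (λ x → sumMap (F x) ys) xs

pairSum-partition : (F : A → A → ℕ) → (∀ x y → F x y ≡ F y x) → (p : A → Bool) (xs : List A) →
  pairSum F xs ≡ pairSum F (filterᵇ p xs) + pairSum F (filterᵇ (not ∘ p) xs)
                 + crossSum F (filterᵇ p xs) (filterᵇ (not ∘ p) xs)
pairSum-partition F F-sym p [] = refl
pairSum-partition F F-sym p (x ∷ xs) with p x
... | true  rewrite pairSum-∷ F x xs | pairSum-∷ F x (filterᵇ p xs)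
                  | pairSum-partition F F-sym p xs | sumMap-partition (F x) p xs =
  shuffle (sumMap (F x) (filterᵇ p xs)) (sumMap (F x) (filterᵇ (not ∘ p) xs))
          (pairSum F (filterᵇ p xs)) (pairSum F (filterᵇ (not ∘ p) xs))
          (crossSum F (filterᵇ p xs) (filterᵇ (not ∘ p) xs))
  where
  shuffle : ∀ a b c d e → a + b + (c + d + e) ≡ a + c + d + (b + e)
  shuffle = solve-∀
... | false rewrite pairSum-∷ F x xs | pairSum-∷ F x (filterᵇ (not ∘ p) xs)
                  | pairSum-partition F F-sym p xs | sumMap-partition (F x) p xs
                  | crossSum-∷ʳ F (filterᵇ p xs) x (filterᵇ (not ∘ p) xs)
                  | sumMap-cong (λ y → F-sym y x) (filterᵇ p xs) =
  shuffle (sumMap (F x) (filterᵇ p xs)) (sumMap (F x) (filterᵇ (not ∘ p) xs))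
          (pairSum F (filterᵇ p xs)) (pairSum F (filterᵇ (not ∘ p) xs))
          (crossSum F (filterᵇ p xs) (filterᵇ (not ∘ p) xs))
  where
  shuffle : ∀ a b c d e → a + b + (c + d + e) ≡ c + (b + d) + (a + e)
  shuffle = solve-∀

pairSum-map-local : {P : A → Set} (F : A → A → ℕ) (F′ : B → B → ℕ) (g : A → B) →
  (∀ {x y} → P x → P y → F x y ≡ F′ (g x) (g y)) → ∀ {xs} → All P xs → pairSum F xs ≡ pairSum F′ (map g xs)
pairSum-map-local F F′ g F≗F′ {[]} [] = refl
pairSum-map-local F F′ g F≗F′ {x ∷ xs} (px ∷ pxs) = begin
  pairSum F (x ∷ xs)                               ≡⟨ pairSum-∷ F x xs ⟩
  sumMap (F x) xs + pairSum F xs                   ≡⟨ cong₂ _+_ (sumMap-cong-local (F≗F′ px) pxs)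
                                                                (pairSum-map-local F F′ g F≗F′ pxs) ⟩
  sumMap (F′ (g x) ∘ g) xs + pairSum F′ (map g xs) ≡⟨ cong (_+ _) (sumMap-map (F′ (g x)) g xs) ⟨
  sumMap (F′ (g x)) (map g xs) + pairSum F′ (map g xs) ≡⟨ pairSum-∷ F′ (g x) (map g xs) ⟨
  pairSum F′ (map g (x ∷ xs))                      ∎
  where open ≡-Reasoning

allFin-suc : ∀ n → allFin (suc n) ≡ zero ∷ map suc (allFin n)
allFin-suc n = cong (zero ∷_) (sym (map-tabulate id suc))

allFin-+ : ∀ a b → allFin (a + b) ≡ map (_↑ˡ b) (allFin a) ++ map (a ↑ʳ_) (allFin b)
allFin-+ zero    b = sym (map-id (allFin b))
allFin-+ (suc a) b = begin
  allFin (suc a + b)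
    ≡⟨ allFin-suc (a + b) ⟩
  zero ∷ map suc (allFin (a + b))
    ≡⟨ cong (λ xs → zero ∷ map suc xs) (allFin-+ a b) ⟩
  zero ∷ map suc (map (_↑ˡ b) (allFin a) ++ map (a ↑ʳ_) (allFin b))
    ≡⟨ cong (zero ∷_) (map-++ suc (map (_↑ˡ b) (allFin a)) (map (a ↑ʳ_) (allFin b))) ⟩
  zero ∷ (map suc (map (_↑ˡ b) (allFin a)) ++ map suc (map (a ↑ʳ_) (allFin b)))
    -- suc (i ↑ˡ b) reduces to suc i ↑ˡ b, so map-∘ can be used in both directions here
    ≡⟨ cong (zero ∷_) (cong₂ _++_ (trans (sym (map-∘ (allFin a))) (map-∘ (allFin a))) (sym (map-∘ (allFin b)))) ⟩
  map (_↑ˡ b) (zero ∷ map suc (allFin a)) ++ map (suc a ↑ʳ_) (allFin b)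
    ≡⟨ cong (λ xs → map (_↑ˡ b) xs ++ map (suc a ↑ʳ_) (allFin b)) (allFin-suc a) ⟨
  map (_↑ˡ b) (allFin (suc a)) ++ map (suc a ↑ʳ_) (allFin b)
    ∎
  where open ≡-Reasoning

module _ {a b : ℕ} where

  concatMap-allFin-+ : (f : Fin (a + b) → List A) → concatMap f (allFin (a + b)) ≡
                       concatMap (f ∘ (_↑ˡ b)) (allFin a) ++ concatMap (f ∘ (a ↑ʳ_)) (allFin b)
  concatMap-allFin-+ f = trans (cong (concatMap f) (allFin-+ a b))
    (trans (concatMap-++ f (map (_↑ˡ b) (allFin a)) _)
           (cong₂ _++_ (concatMap-map f (_↑ˡ b) (allFin a)) (concatMap-map f (a ↑ʳ_) (allFin b))))

  filterᵇ-allFin-+ : (p : Fin (a + b) → Bool) → filterᵇ p (allFin (a + b)) ≡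
    map (_↑ˡ b) (filterᵇ (p ∘ (_↑ˡ b)) (allFin a)) ++ map (a ↑ʳ_) (filterᵇ (p ∘ (a ↑ʳ_)) (allFin b))
  filterᵇ-allFin-+ p = trans (cong (filterᵇ p) (allFin-+ a b))
    (trans (filter-++ (T? ∘ p) (map (_↑ˡ b) (allFin a)) _)
           (cong₂ _++_ (filterᵇ-map p (_↑ˡ b) (allFin a)) (filterᵇ-map p (a ↑ʳ_) (allFin b))))

concatMap-[] : (F : A → List B) → (∀ x → F x ≡ []) → ∀ xs → concatMap F xs ≡ []
concatMap-[] F F≡[] []       = refl
concatMap-[] F F≡[] (x ∷ xs) rewrite F≡[] x = concatMap-[] F F≡[] xs

concatMap-allFin-single : ∀ {n} (F : Fin n → List A) (x : Fin n) → (∀ i → i ≢ x → F i ≡ []) →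
                          concatMap F (allFin n) ≡ F x
concatMap-allFin-single {n = suc n} F x F≡[] =
  trans (cong (concatMap F) (allFin-suc n)) (trans (cong (F zero ++_) (concatMap-map F suc (allFin n))) (split x F≡[]))
  where
  split : ∀ x → (∀ i → i ≢ x → F i ≡ []) → F zero ++ concatMap (F ∘ suc) (allFin n) ≡ F x
  split zero    F≡[] = trans (cong (F zero ++_) (concatMap-[] (F ∘ suc) (λ i → F≡[] (suc i) λ ()) (allFin n)))
                             (++-identityʳ (F zero))
  split (suc x) F≡[] rewrite F≡[] zero (λ ()) =
    concatMap-allFin-single (F ∘ suc) x (λ i i≢x → F≡[] (suc i) (i≢x ∘ Finₚ.suc-injective))

sumMap-allFin : ∀ n (f : Fin n → ℕ) → sumMap f (allFin n) ≡ ∑[ i < n ] f i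
sumMap-allFin zero    f = refl
sumMap-allFin (suc n) f = cong (f zero +_) (begin
  sumMap f (tabulate suc)       ≡⟨ cong (sumMap f) (map-tabulate id suc) ⟨
  sumMap f (map suc (allFin n)) ≡⟨ sumMap-map f suc (allFin n) ⟩
  sumMap (f ∘ suc) (allFin n)   ≡⟨ sumMap-allFin n (f ∘ suc) ⟩
  ∑[ i < n ] f (suc i)          ∎)
  where open ≡-Reasoning

<ᵇ-≡-true : ∀ {m n} → m < n → (m <ᵇ n) ≡ true
<ᵇ-≡-true m<n = Equivalence.to T-≡ (<⇒<ᵇ m<n)

<ᵇ-≡-false : ∀ {m n} → n ≤ m → (m <ᵇ n) ≡ false
<ᵇ-≡-false {m} {n} n≤m with m <ᵇ n in m<ᵇn
... | false = refl
... | true  = contradiction (<ᵇ⇒< m n (subst T (sym m<ᵇn) _)) (≤⇒≯ n≤m)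

+-<ᵇ-+ : ∀ m j k → (m + j <ᵇ m + k) ≡ (j <ᵇ k)
+-<ᵇ-+ zero    j k = refl
+-<ᵇ-+ (suc m) j k = +-<ᵇ-+ m j k

Unique-length-≤ : ∀ {n} (xs : List (Fin n)) → Unique xs → length xs ≤ n
Unique-length-≤ {n} xs xs! with length xs ≤? n
... | yes |xs|≤n = |xs|≤n
... | no  |xs|≰n with pigeonhole (≰⇒> |xs|≰n) (lookup xs)
...   | i , j , i<j , xsᵢ≡xsⱼ = contradiction xsᵢ≡xsⱼ (lookup-injective xs! i<j)
  where
  lookup-injective : ∀ {ys : List (Fin n)} → Unique ys → ∀ {i j} → i Fin.< j → lookup ys i ≢ lookup ys j
  lookup-injective (y∉ys ∷ _)   {zero}  {suc j} _         = All.lookup y∉ys (∈-lookup j)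
  lookup-injective (_ ∷ ys!) {suc i} {suc j} (s≤s i<j) = lookup-injective ys! i<j

module _ {n : ℕ} {G : Graph n} where

  private variable
    x y z : Fin n

  len : Walk G x y → ℕ
  len here       = 0
  len (step _ w) = suc (len w)

  _++ʷ_ : Walk G x y → Walk G y z → Walk G x z
  here     ++ʷ w = w
  step e v ++ʷ w = step e (v ++ʷ w)

  len-++ʷ : (v : Walk G x y) (w : Walk G y z) → len (v ++ʷ w) ≡ len v + len w
  len-++ʷ here       w = refl
  len-++ʷ (step e v) w = cong suc (len-++ʷ v w)

  snocʷ : Walk G x y → G y z ≡ true → Walk G x z
  snocʷ w e = w ++ʷ step e here

  len-snocʷ : (w : Walk G x y) (e : G y z ≡ true) → len (snocʷ w e) ≡ suc (len w)
  len-snocʷ w e = trans (len-++ʷ w (step e here)) (+-comm (len w) 1)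

  unsnocʷ : ∀ {k} (w : Walk G x z) → len w ≡ suc k →
            Σ (Fin n) λ y → Σ (Walk G x y) λ v → len v ≡ k × G y z ≡ true
  unsnocʷ         (step e here)       |w|≡1+k = _ , here , suc-injective |w|≡1+k , e
  unsnocʷ {k = suc k} (step e (step e′ w)) |w|≡1+k
    with y , v , |v|≡k , e″ ← unsnocʷ (step e′ w) (suc-injective |w|≡1+k) =
    y , step e v , cong suc |v|≡k , e″

  reverseʷ : (∀ a b → G a b ≡ G b a) → Walk G x y → Walk G y x
  reverseʷ G-sym here       = here
  reverseʷ G-sym (step e w) = snocʷ (reverseʷ G-sym w) (trans (G-sym _ _) e)

  len-reverseʷ : (G-sym : ∀ a b → G a b ≡ G b a) (w : Walk G x y) → len (reverseʷ G-sym w) ≡ len w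
  len-reverseʷ G-sym here       = refl
  len-reverseʷ G-sym (step e w) =
    trans (len-snocʷ (reverseʷ G-sym w) _) (cong suc (len-reverseʷ G-sym w))

  vertices : Walk G x y → List (Fin n)
  vertices {x} here       = x ∷ []
  vertices {x} (step _ w) = x ∷ vertices w

  length-vertices : (w : Walk G x y) → length (vertices w) ≡ suc (len w)
  length-vertices here       = refl
  length-vertices (step _ w) = cong suc (length-vertices w)

module _ {n : ℕ} (G : Graph n) where

  private variable
    x y z : Fin n

  open DecMembership (_≟_ {n}) using (_∈?_)

  WalkWithin : ℕ → Fin n → Fin n → Set
  WalkWithin d x y = Σ (Walk G x y) λ w → len w ≤ d

  reachWithin-sound : ∀ k → T (reachWithin G k x y) → WalkWithin k x y
  reachWithin-sound {x} {y} zero r with x ≟ y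
  ... | yes refl = here , z≤n
  reachWithin-sound {x} {y} (suc k) r with Equivalence.to T-∨ r
  ... | inj₁ r′ = Product.map₂ m≤n⇒m≤1+n (reachWithin-sound k r′)
  ... | inj₂ r′ with z , r″ ← Any.satisfied (any⁻ _ (allFin n) r′)
    with rₖ , e ← Equivalence.to T-∧ r″
    with w , |w|≤k ← reachWithin-sound k rₖ =
    snocʷ w (Equivalence.to T-≡ e) , subst (_≤ suc k) (sym (len-snocʷ w _)) (s≤s |w|≤k)

  reachWithin-complete : ∀ k (w : Walk G x y) → len w ≤ k → T (reachWithin G k x y)
  reachWithin-complete {x} zero here _ with x ≟ x
  ... | yes _  = _
  ... | no x≢x = contradiction refl x≢x
  reachWithin-complete (suc k) w |w|≤1+k with len w ≤? k
  ... | yes |w|≤k = Equivalence.from T-∨ (inj₁ (reachWithin-complete k w |w|≤k))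
  ... | no  |w|≰k with z , v , |v|≡k , e ← unsnocʷ w (≤-antisym |w|≤1+k (≰⇒> |w|≰k)) =
    Equivalence.from T-∨ (inj₂ (any⁺ _ (lose (∈-allFin z)
      (Equivalence.from T-∧ (reachWithin-complete k v (≤-reflexive |v|≡k) , Equivalence.from T-≡ e)))))

  distAux-≤ : ∀ j f k → T (reachWithin G j x y) → k ≤ j → distAux G x y f k ≤ j
  distAux-≤         j zero    k _ k≤j = k≤j
  distAux-≤ {x} {y} j (suc f) k r k≤j with reachWithin G k x y in rₖ
  ... | true  = k≤j
  ... | false = distAux-≤ j f (suc k) r (≤∧≢⇒< k≤j λ { refl → subst T rₖ r })

  distAux-reaches : ∀ j f k → T (reachWithin G j x y) → k ≤ j → j < k + f →
                    T (reachWithin G (distAux G x y f k) x y)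
  distAux-reaches         j zero    k _ k≤j j<k+0 =
    contradiction (≤-trans j<k+0 (≤-reflexive (+-identityʳ k))) (≤⇒≯ k≤j)
  distAux-reaches {x} {y} j (suc f) k r k≤j j<k+1+f with reachWithin G k x y in rₖ
  ... | true  = subst T (sym rₖ) _
  ... | false = distAux-reaches j f (suc k) r (≤∧≢⇒< k≤j λ { refl → subst T rₖ r })
                  (subst (j <_) (+-suc k f) j<k+1+f)

  dist-≤-len : (w : Walk G x y) → dist G x y ≤ len w
  dist-≤-len w = distAux-≤ (len w) n 0 (reachWithin-complete (len w) w ≤-refl) z≤n

  dist-≤ : ∀ {d} → WalkWithin d x y → dist G x y ≤ d
  dist-≤ (w , |w|≤d) = ≤-trans (dist-≤-len w) |w|≤d

  dist-refl : ∀ x → dist G x x ≡ 0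
  dist-refl x = n≤0⇒n≡0 (dist-≤-len {x} here)

  SimpleWalk : Fin n → Fin n → Set
  SimpleWalk x y = Σ (Walk G x y) (Unique ∘ vertices)

  suffixFrom : (w : Walk G y z) → x ∈ vertices w → Unique (vertices w) →
               Σ (SimpleWalk x z) λ (v , _) → len v ≤ len w
  suffixFrom here         (here refl) w! = (here , w!) , z≤n
  suffixFrom (step e w) (here refl) w! = (step e w , w!) , ≤-refl
  suffixFrom (step e w) (there x∈w) (_ ∷ w!) = Product.map₂ m≤n⇒m≤1+n (suffixFrom w x∈w w!)

  loopErase : (w : Walk G x y) → Σ (SimpleWalk x y) λ (v , _) → len v ≤ len w
  loopErase here = (here , [] ∷ []) , z≤n
  loopErase {x} (step e w) with (v , v!) , |v|≤|w| ← loopErase w with x ∈? vertices v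
  ... | yes x∈v = Product.map₂ (λ |u|≤|v| → m≤n⇒m≤1+n (≤-trans |u|≤|v| |v|≤|w|)) (suffixFrom v x∈v v!)
  ... | no  x∉v = (step e v , ¬Any⇒All¬ _ x∉v ∷ v!) , s≤s |v|≤|w|

  simpleWalk-len< : ((w , w!) : SimpleWalk x y) → len w < n
  simpleWalk-len< (w , w!) = subst (_≤ n) (length-vertices w) (Unique-length-≤ (vertices w) w!)

  -- Loop erasure gives a walk of length < n, so the search in distAux, which gives up after n steps,
  -- reaches the distance.
  shortestWalk : Walk G x y → WalkWithin (dist G x y) x y
  shortestWalk w with (v , v!) , _ ← loopErase w =
    reachWithin-sound (dist G _ _)
      (distAux-reaches (len v) n 0 (reachWithin-complete (len v) v ≤-refl) z≤n (simpleWalk-len< (v , v!)))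

  dist-sym : IsSimple G → Connected G → ∀ x y → dist G x y ≡ dist G y x
  dist-sym S C x y = ≤-antisym (dist-≤-dist x y) (dist-≤-dist y x)
    where
    dist-≤-dist : ∀ x y → dist G x y ≤ dist G y x
    dist-≤-dist x y with w , |w|≤d ← shortestWalk (C y x) = begin
      dist G x y                                     ≤⟨ dist-≤-len (reverseʷ (IsSimple.symmetric S) w) ⟩
      len (reverseʷ (IsSimple.symmetric S) w)        ≡⟨ len-reverseʷ (IsSimple.symmetric S) w ⟩
      len w                                          ≤⟨ |w|≤d ⟩
      dist G y x                                     ∎
      where open ≤-Reasoning

  dist-triangle : Connected G → ∀ x y z → dist G x z ≤ dist G x y + dist G y z
  dist-triangle C x y z with v , |v|≤dxy ← shortestWalk (C x y) | w , |w|≤dyz ← shortestWalk (C y z) = begin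
    dist G x z         ≤⟨ dist-≤-len (v ++ʷ w) ⟩
    len (v ++ʷ w)      ≡⟨ len-++ʷ v w ⟩
    len v + len w      ≤⟨ +-mono-≤ |v|≤dxy |w|≤dyz ⟩
    dist G x y + dist G y z ∎
    where open ≤-Reasoning

module _ {n : ℕ} {G : Graph n} where

  _⊕ʷ_ : ∀ {d d′ x y z} → WalkWithin G d x y → WalkWithin G d′ y z → WalkWithin G (d + d′) x z
  (v , |v|≤d) ⊕ʷ (w , |w|≤d′) = v ++ʷ w , subst (_≤ _) (sym (len-++ʷ v w)) (+-mono-≤ |v|≤d |w|≤d′)

  weakenʷ : ∀ {d d′ x y} → d ≤ d′ → WalkWithin G d x y → WalkWithin G d′ x y
  weakenʷ d≤d′ = Product.map₂ (λ |w|≤d → ≤-trans |w|≤d d≤d′)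

module _ {m n : ℕ} {G : Graph m} {H : Graph n} (f : Fin m → Fin n)
         (f-hom : ∀ {u v} → G u v ≡ true → H (f u) (f v) ≡ true) where

  mapʷ : ∀ {x y} → Walk G x y → Walk H (f x) (f y)
  mapʷ here       = here
  mapʷ (step e w) = step (f-hom e) (mapʷ w)

  len-mapʷ : ∀ {x y} (w : Walk G x y) → len (mapʷ w) ≡ len w
  len-mapʷ here       = refl
  len-mapʷ (step e w) = cong suc (len-mapʷ w)

  mapWithin : ∀ {d x y} → WalkWithin G d x y → WalkWithin H d (f x) (f y)
  mapWithin (w , |w|≤d) = mapʷ w , subst (_≤ _) (sym (len-mapʷ w)) |w|≤d

module _ {n : ℕ} (G : Graph n) where

  forwardAdj : Fin n → Fin n → Bool
  forwardAdj i j = (toℕ i <ᵇ toℕ j) ∧ G i j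

  row : Fin n → List (Edge n)
  row i = map (i ,_) (filterᵇ (forwardAdj i) (allFin n))

  numEdges-∑ : numEdges G ≡ ∑[ i < n ] ∑[ j < n ] 𝟙 (forwardAdj i j)
  numEdges-∑ = begin
    length (concatMap row (allFin n))                       ≡⟨ length-concatMap row (allFin n) ⟩
    sumMap (length ∘ row) (allFin n)                        ≡⟨ sumMap-cong length-row (allFin n) ⟩
    sumMap (λ i → ∑[ j < n ] 𝟙 (forwardAdj i j)) (allFin n) ≡⟨ sumMap-allFin n _ ⟩
    ∑[ i < n ] ∑[ j < n ] 𝟙 (forwardAdj i j)                ∎
    where
    open ≡-Reasoning
    length-row : ∀ i → length (row i) ≡ ∑[ j < n ] 𝟙 (forwardAdj i j)
    length-row i = trans (length-map (i ,_) (filterᵇ (forwardAdj i) (allFin n)))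
                         (trans (length-filterᵇ (forwardAdj i) (allFin n)) (sumMap-allFin n _))

  module _ (S : IsSimple G) where
    open IsSimple S

    𝟙-adj-split : ∀ i j → 𝟙 (G i j) ≡ 𝟙 (forwardAdj i j) + 𝟙 (forwardAdj j i)
    𝟙-adj-split i j with Finₚ.<-cmp i j
    ... | tri< i<j _ _ rewrite <ᵇ-≡-true i<j | <ᵇ-≡-false (<⇒≤ i<j) = sym (+-identityʳ _)
    ... | tri≈ _ refl _ rewrite <ᵇ-≡-false (≤-refl {toℕ i}) | irreflexive i = refl
    ... | tri> _ _ j<i rewrite <ᵇ-≡-true j<i | <ᵇ-≡-false (<⇒≤ j<i) = cong 𝟙 (symmetric i j)

    handshake : numEdges G * 2 ≡ ∑[ i < n ] ∑[ j < n ] 𝟙 (G i j)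
    handshake = sym (begin
      ∑[ i < n ] ∑[ j < n ] 𝟙 (G i j)
        ≡⟨ sum-cong-≗ (λ i → sum-cong-≗ (𝟙-adj-split i)) ⟩
      ∑[ i < n ] ∑[ j < n ] (F i j + F j i)
        ≡⟨ sum-cong-≗ (λ i → ∑-distrib-+ (F i) (λ j → F j i)) ⟩
      ∑[ i < n ] (∑[ j < n ] F i j + ∑[ j < n ] F j i)
        ≡⟨ ∑-distrib-+ (λ i → ∑[ j < n ] F i j) (λ i → ∑[ j < n ] F j i) ⟩
      m + ∑[ i < n ] ∑[ j < n ] F j i                            ≡⟨ cong (m +_) (∑-comm (λ i j → F j i)) ⟩
      m + m                                                      ≡⟨ cong (m +_) (+-identityʳ m) ⟨
      2 * m                                                      ≡⟨ *-comm 2 m ⟩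
      m * 2                                                      ≡⟨ cong (_* 2) numEdges-∑ ⟨
      numEdges G * 2                                             ∎)
      where
      open ≡-Reasoning
      F : Fin n → Fin n → ℕ
      F i j = 𝟙 (forwardAdj i j)
      m = ∑[ i < n ] ∑[ j < n ] F i j

removeVertex : ∀ {n} → Graph (suc n) → Fin (suc n) → Graph n
removeVertex G y j j′ = G (punchIn y j) (punchIn y j′)

spokes : ∀ {n} → Graph (suc n) → Fin (suc n) → List (Edge (suc n))
spokes {n} G y = map (λ j → y , punchIn y j) (filterᵇ (G y ∘ punchIn y) (allFin n))

numEdges-removeVertex : ∀ {n} (G : Graph (suc n)) (y : Fin (suc n)) → IsSimple G →
                        numEdges G ≡ length (spokes G y) + numEdges (removeVertex G y)
numEdges-removeVertex {n} G y S = *-cancelʳ-≡ _ _ 2 (begin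
  numEdges G * 2                                                        ≡⟨ handshake G S ⟩
  ∑[ w < suc n ] ∑[ w′ < suc n ] 𝟙 (G w w′)
    ≡⟨ sum-remove {i = y} (λ w → ∑[ w′ < suc n ] 𝟙 (G w w′)) ⟩
  ∑[ w′ < suc n ] 𝟙 (G y w′) + ∑[ j < n ] ∑[ w′ < suc n ] 𝟙 (G (punchIn y j) w′)
    ≡⟨ cong₂ _+_ (sum-remove {i = y} (𝟙 ∘ G y)) (sum-cong-≗ (λ j → sum-remove {i = y} (𝟙 ∘ G (punchIn y j)))) ⟩
  (𝟙 (G y y) + deg) + ∑[ j < n ] (𝟙 (G (punchIn y j) y) + ∑[ j′ < n ] 𝟙 (G⁻ j j′))
    ≡⟨ cong₂ _+_ (cong (λ b → 𝟙 b + deg) (irreflexive y))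
                 (∑-distrib-+ (λ j → 𝟙 (G (punchIn y j) y)) (λ j → ∑[ j′ < n ] 𝟙 (G⁻ j j′))) ⟩
  deg + (∑[ j < n ] 𝟙 (G (punchIn y j) y) + ∑[ j < n ] ∑[ j′ < n ] 𝟙 (G⁻ j j′))
    ≡⟨ cong₂ (λ d e → deg + (d + e)) (sum-cong-≗ (λ j → cong 𝟙 (symmetric (punchIn y j) y)))
                                      (sym (handshake G⁻ S⁻)) ⟩
  deg + (deg + numEdges G⁻ * 2)                                          ≡⟨ regroup deg (numEdges G⁻) ⟩
  (deg + numEdges G⁻) * 2
    ≡⟨ cong (λ d → (d + numEdges G⁻) * 2) length-spokes ⟨
  (length (spokes G y) + numEdges G⁻) * 2                                ∎)
  where
  open ≡-Reasoning
  open IsSimple S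
  G⁻ = removeVertex G y
  S⁻ : IsSimple G⁻
  S⁻ = record { symmetric = λ j j′ → symmetric _ _ ; irreflexive = λ j → irreflexive _ }
  deg = ∑[ j < n ] 𝟙 (G y (punchIn y j))
  length-spokes : length (spokes G y) ≡ deg
  length-spokes = trans (length-map _ (filterᵇ (G y ∘ punchIn y) (allFin n)))
                        (trans (length-filterᵇ _ (allFin n)) (sumMap-allFin n _))
  regroup : ∀ d e → d + (d + e * 2) ≡ (d + e) * 2
  regroup = solve-∀

rootedEdges : ∀ {n} → Graph (suc n) → Fin (suc n) → List (Edge (suc n))
rootedEdges G y = spokes G y ++ map (Product.map (punchIn y) (punchIn y)) (edges (removeVertex G y))

length-rootedEdges : ∀ {n} (G : Graph (suc n)) (y : Fin (suc n)) → IsSimple G →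
                     length (rootedEdges G y) ≡ numEdges G
length-rootedEdges G y S = trans (length-++ (spokes G y))
  (trans (cong (length (spokes G y) +_) (length-map _ (edges (removeVertex G y))))
         (sym (numEdges-removeVertex G y S)))

All-edges : ∀ {n} (G : Graph n) → All (λ (s , t) → G s t ≡ true) (edges G)
All-edges {n} G = concat⁺ (map⁺ (All.universal All-row (allFin n)))
  where
  fwd⇒adj : ∀ {i j} → T (forwardAdj G i j) → G i j ≡ true
  fwd⇒adj fwd = Equivalence.to T-≡ (proj₂ (Equivalence.to T-∧ fwd))

  All-row : ∀ i → All (λ (s , t) → G s t ≡ true) (row G i)
  All-row i = map⁺ (All.map fwd⇒adj (all-filter (T? ∘ forwardAdj G i) (allFin n)))

module _ {a b : ℕ} (G : Graph (a + b)) where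

  filterᵇ-row-+ : (q : Fin (a + b) → Bool) (s : Fin (a + b)) {pˡ : Fin a → Bool} {pʳ : Fin b → Bool} →
    (∀ i → forwardAdj G s (i ↑ˡ b) ∧ q (i ↑ˡ b) ≡ pˡ i) → (∀ j → forwardAdj G s (a ↑ʳ j) ∧ q (a ↑ʳ j) ≡ pʳ j) →
    filterᵇ (q ∘ proj₂) (row G s) ≡
    map (λ i → s , i ↑ˡ b) (filterᵇ pˡ (allFin a)) ++ map (λ j → s , a ↑ʳ j) (filterᵇ pʳ (allFin b))
  filterᵇ-row-+ q s {pˡ} {pʳ} pˡ-spec pʳ-spec = begin
    filterᵇ (q ∘ proj₂) (map (s ,_) (filterᵇ (forwardAdj G s) (allFin (a + b))))
      ≡⟨ filterᵇ-map (q ∘ proj₂) (s ,_) (filterᵇ (forwardAdj G s) (allFin (a + b))) ⟩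
    map (s ,_) (filterᵇ q (filterᵇ (forwardAdj G s) (allFin (a + b))))
      ≡⟨ cong (map (s ,_)) (filterᵇ-filterᵇ (forwardAdj G s) q (allFin (a + b))) ⟩
    map (s ,_) (filterᵇ p (allFin (a + b)))
      ≡⟨ cong (map (s ,_)) (filterᵇ-allFin-+ {a} {b} p) ⟩
    map (s ,_) (map (_↑ˡ b) (filterᵇ (p ∘ (_↑ˡ b)) (allFin a)) ++ map (a ↑ʳ_) (filterᵇ (p ∘ (a ↑ʳ_)) (allFin b)))
      ≡⟨ cong (map (s ,_)) (cong₂ (λ l r → map (_↑ˡ b) l ++ map (a ↑ʳ_) r)
                                  (filterᵇ-cong pˡ-spec (allFin a)) (filterᵇ-cong pʳ-spec (allFin b))) ⟩
    map (s ,_) (map (_↑ˡ b) (filterᵇ pˡ (allFin a)) ++ map (a ↑ʳ_) (filterᵇ pʳ (allFin b)))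
      ≡⟨ map-++ (s ,_) (map (_↑ˡ b) (filterᵇ pˡ (allFin a))) _ ⟩
    map (s ,_) (map (_↑ˡ b) (filterᵇ pˡ (allFin a))) ++ map (s ,_) (map (a ↑ʳ_) (filterᵇ pʳ (allFin b)))
      ≡⟨ cong₂ _++_ (map-∘ (filterᵇ pˡ (allFin a))) (map-∘ (filterᵇ pʳ (allFin b))) ⟨
    map (λ i → s , i ↑ˡ b) (filterᵇ pˡ (allFin a)) ++ map (λ j → s , a ↑ʳ j) (filterᵇ pʳ (allFin b)) ∎
    where
    open ≡-Reasoning
    p = λ t → forwardAdj G s t ∧ q t

distToEdge : ∀ {n} → Graph n → Fin n → Edge n → ℕ
distToEdge G c (u₁ , u₂) = dist G c u₁ ⊓ dist G c u₂

totalDistToEdges : ∀ {n} → Graph n → Fin n → ℕ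
totalDistToEdges G c = sumMap (distToEdge G c) (edges G)

+-⊓-+ : ∀ α₁ α₂ β₁ β₂ → ((α₁ + β₁) ⊓ (α₁ + β₂)) ⊓ ((α₂ + β₁) ⊓ (α₂ + β₂)) ≡ α₁ ⊓ α₂ + β₁ ⊓ β₂
+-⊓-+ α₁ α₂ β₁ β₂ = begin
  ((α₁ + β₁) ⊓ (α₁ + β₂)) ⊓ ((α₂ + β₁) ⊓ (α₂ + β₂)) ≡⟨ cong₂ _⊓_ (+-distribˡ-⊓ α₁ β₁ β₂) (+-distribˡ-⊓ α₂ β₁ β₂) ⟨
  (α₁ + β₁ ⊓ β₂) ⊓ (α₂ + β₁ ⊓ β₂)                   ≡⟨ +-distribʳ-⊓ (β₁ ⊓ β₂) α₁ α₂ ⟨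
  α₁ ⊓ α₂ + β₁ ⊓ β₂                                 ∎
  where open ≡-Reasoning

module _ {n : ℕ} (G : Graph n) where

  edgeDist-sym : (∀ s t → dist G s t ≡ dist G t s) → ∀ e f → edgeDist G e f ≡ edgeDist G f e
  edgeDist-sym d-sym (u₁ , u₂) (v₁ , v₂) = cong suc (begin
    (dist G u₁ v₁ ⊓ dist G u₁ v₂) ⊓ (dist G u₂ v₁ ⊓ dist G u₂ v₂) ≡⟨ ⊓-interchange _ _ _ _ ⟩
    (dist G u₁ v₁ ⊓ dist G u₂ v₁) ⊓ (dist G u₁ v₂ ⊓ dist G u₂ v₂)
      ≡⟨ cong₂ _⊓_ (cong₂ _⊓_ (d-sym u₁ v₁) (d-sym u₂ v₁)) (cong₂ _⊓_ (d-sym u₁ v₂) (d-sym u₂ v₂)) ⟩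
    (dist G v₁ u₁ ⊓ dist G v₁ u₂) ⊓ (dist G v₂ u₁ ⊓ dist G v₂ u₂) ∎)
    where open ≡-Reasoning

  distToEdge-shift-≤ : ∀ {c c′ Δ} → (∀ s → dist G c s ≤ Δ + dist G c′ s) →
                       ∀ e → distToEdge G c e ≤ Δ + distToEdge G c′ e
  distToEdge-shift-≤ {c} {c′} {Δ} d≤ (u₁ , u₂) =
    ≤-trans (⊓-mono-≤ (d≤ u₁) (d≤ u₂)) (≤-reflexive (sym (+-distribˡ-⊓ Δ (dist G c′ u₁) (dist G c′ u₂))))

  distToEdge-shift-≡ : ∀ {c c′ Δ} {(u₁ , u₂) : Edge n} →
                       dist G c′ u₁ ≡ Δ + dist G c u₁ → dist G c′ u₂ ≡ Δ + dist G c u₂ →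
                       distToEdge G c′ (u₁ , u₂) ≡ Δ + distToEdge G c (u₁ , u₂)
  distToEdge-shift-≡ {c} {c′} {Δ} {u₁ , u₂} d₁≡ d₂≡ =
    trans (cong₂ _⊓_ d₁≡ d₂≡) (sym (+-distribˡ-⊓ Δ (dist G c u₁) (dist G c u₂)))

module Glued {a b : ℕ} (X : Graph a) (x : Fin a) (Y : Graph (suc b)) (y : Fin (suc b)) where

  Gl : Graph (a + b)
  Gl = glue X x Y y

  adj⊎ : Fin a ⊎ Fin b → Fin a ⊎ Fin b → Bool
  adj⊎ (inj₁ i) (inj₁ i′) = X i i′
  adj⊎ (inj₁ i) (inj₂ j)  = ⌊ i ≟ x ⌋ ∧ Y y (punchIn y j)
  adj⊎ (inj₂ j) (inj₁ i)  = ⌊ i ≟ x ⌋ ∧ Y (punchIn y j) y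
  adj⊎ (inj₂ j) (inj₂ j′) = Y (punchIn y j) (punchIn y j′)

  glue-splitAt : ∀ s t → Gl s t ≡ adj⊎ (splitAt a s) (splitAt a t)
  glue-splitAt s t with splitAt a s | splitAt a t
  ... | inj₁ _ | inj₁ _ = refl
  ... | inj₁ _ | inj₂ _ = refl
  ... | inj₂ _ | inj₁ _ = refl
  ... | inj₂ _ | inj₂ _ = refl

  glue-join : ∀ σ τ → Gl (join a b σ) (join a b τ) ≡ adj⊎ σ τ
  glue-join σ τ rewrite glue-splitAt (join a b σ) (join a b τ) | splitAt-join a b σ | splitAt-join a b τ = refl

  projX⊎ : Fin a ⊎ Fin b → Fin a
  projX⊎ (inj₁ i) = i
  projX⊎ (inj₂ _) = x

  projY⊎ : Fin a ⊎ Fin b → Fin (suc b)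
  projY⊎ (inj₁ _) = y
  projY⊎ (inj₂ j) = punchIn y j

  projX : Fin (a + b) → Fin a
  projX s = projX⊎ (splitAt a s)

  projY : Fin (a + b) → Fin (suc b)
  projY s = projY⊎ (splitAt a s)

  projX-join : ∀ σ → projX (join a b σ) ≡ projX⊎ σ
  projX-join σ = cong projX⊎ (splitAt-join a b σ)

  projY-join : ∀ σ → projY (join a b σ) ≡ projY⊎ σ
  projY-join σ = cong projY⊎ (splitAt-join a b σ)

  Projection⊎ : Fin a ⊎ Fin b → Fin a ⊎ Fin b → ℕ → Set
  Projection⊎ σ τ d =
    Σ (Walk X (projX⊎ σ) (projX⊎ τ)) λ u → Σ (Walk Y (projY⊎ σ) (projY⊎ τ)) λ v → len u + len v ≤ d

  projectStep : ∀ σ τ → adj⊎ σ τ ≡ true → Projection⊎ σ τ 1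
  projectStep (inj₁ i) (inj₁ i′) e = step e here , here , ≤-refl
  projectStep (inj₁ i) (inj₂ j)  e with i ≟ x
  ... | yes refl = here , step e here , ≤-refl
  projectStep (inj₂ j) (inj₁ i)  e with i ≟ x
  ... | yes refl = here , step e here , ≤-refl
  projectStep (inj₂ j) (inj₂ j′) e = here , step e here , ≤-refl

  -- Each step of Gl is a step in X or in Y, so the two projections of a walk are together no longer.
  projectWalk : ∀ {s t} (w : Walk Gl s t) → Projection⊎ (splitAt a s) (splitAt a t) (len w)
  projectWalk here = here , here , z≤n
  projectWalk {s} (step {y = s′} e w)
    with u₁ , v₁ , |u₁|+|v₁|≤1 ← projectStep (splitAt a s) (splitAt a s′) (trans (sym (glue-splitAt s s′)) e)
       | u , v , |u|+|v|≤|w| ← projectWalk w =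
    u₁ ++ʷ u , v₁ ++ʷ v , (begin
      len (u₁ ++ʷ u) + len (v₁ ++ʷ v)     ≡⟨ cong₂ _+_ (len-++ʷ u₁ u) (len-++ʷ v₁ v) ⟩
      len u₁ + len u + (len v₁ + len v)   ≡⟨ +-interchange (len u₁) (len u) (len v₁) (len v) ⟩
      len u₁ + len v₁ + (len u + len v)   ≤⟨ +-mono-≤ |u₁|+|v₁|≤1 |u|+|v|≤|w| ⟩
      suc (len w)                         ∎)
    where open ≤-Reasoning

  inclX-hom : ∀ {i i′} → X i i′ ≡ true → Gl (i ↑ˡ b) (i′ ↑ˡ b) ≡ true
  inclX-hom {i} {i′} = trans (glue-join (inj₁ i) (inj₁ i′))

  inclY : Fin (suc b) → Fin (a + b)
  inclY w with y ≟ w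
  ... | yes _   = x ↑ˡ b
  ... | no y≢w = a ↑ʳ punchOut y≢w

  inclY-y : inclY y ≡ x ↑ˡ b
  inclY-y with y ≟ y
  ... | yes _   = refl
  ... | no y≢y = contradiction refl y≢y

  inclY-punchIn : ∀ j → inclY (punchIn y j) ≡ a ↑ʳ j
  inclY-punchIn j with y ≟ punchIn y j
  ... | yes y≡yⱼ = contradiction (sym y≡yⱼ) (punchInᵢ≢i y j)
  ... | no  y≢yⱼ = cong (a ↑ʳ_) (trans (punchOut-cong y refl) (punchOut-punchIn y))

  ⌊x≟x⌋ : ⌊ x ≟ x ⌋ ≡ true
  ⌊x≟x⌋ = trans (isYes≗does (x ≟ x)) (dec-true (x ≟ x) refl)

  inclY-hom : (∀ w → Y w w ≡ false) → ∀ {w w′} → Y w w′ ≡ true → Gl (inclY w) (inclY w′) ≡ true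
  inclY-hom Y-irr {w} {w′} e with y ≟ w | y ≟ w′
  ... | yes refl | yes refl  = contradiction (trans (sym e) (Y-irr y)) λ ()
  ... | yes refl | no  y≢w′ = trans (glue-join (inj₁ x) (inj₂ (punchOut y≢w′)))
    (cong₂ _∧_ ⌊x≟x⌋ (trans (cong (Y y) (punchIn-punchOut y≢w′)) e))
  ... | no  y≢w  | yes refl  = trans (glue-join (inj₂ (punchOut y≢w)) (inj₁ x))
    (cong₂ _∧_ ⌊x≟x⌋ (trans (cong (λ v → Y v y) (punchIn-punchOut y≢w)) e))
  ... | no  y≢w  | no  y≢w′ = trans (glue-join (inj₂ (punchOut y≢w)) (inj₂ (punchOut y≢w′)))
    (trans (cong₂ Y (punchIn-punchOut y≢w) (punchIn-punchOut y≢w′)) e)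

  glue-isSimple : IsSimple X → IsSimple Y → IsSimple Gl
  glue-isSimple SX SY = record
    { symmetric   = λ s t → trans (glue-splitAt s t)
                              (trans (adj⊎-sym (splitAt a s) (splitAt a t)) (sym (glue-splitAt t s)))
    ; irreflexive = λ s → trans (glue-splitAt s s) (adj⊎-irr (splitAt a s))
    }
    where
    adj⊎-sym : ∀ σ τ → adj⊎ σ τ ≡ adj⊎ τ σ
    adj⊎-sym (inj₁ i) (inj₁ i′) = IsSimple.symmetric SX i i′
    adj⊎-sym (inj₁ i) (inj₂ j)  = cong (⌊ i ≟ x ⌋ ∧_) (IsSimple.symmetric SY y (punchIn y j))
    adj⊎-sym (inj₂ j) (inj₁ i)  = cong (⌊ i ≟ x ⌋ ∧_) (IsSimple.symmetric SY (punchIn y j) y)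
    adj⊎-sym (inj₂ j) (inj₂ j′) = IsSimple.symmetric SY (punchIn y j) (punchIn y j′)
    adj⊎-irr : ∀ σ → adj⊎ σ σ ≡ false
    adj⊎-irr (inj₁ i) = IsSimple.irreflexive SX i
    adj⊎-irr (inj₂ j) = IsSimple.irreflexive SY (punchIn y j)

  isLeft⊎ : Fin a ⊎ Fin b → Bool
  isLeft⊎ = [ const true , const false ]′

  isLeft : Fin (a + b) → Bool
  isLeft s = isLeft⊎ (splitAt a s)

  isLeft-↑ˡ : ∀ i → isLeft (i ↑ˡ b) ≡ true
  isLeft-↑ˡ i = cong isLeft⊎ (splitAt-↑ˡ a i b)

  isLeft-↑ʳ : ∀ j → isLeft (a ↑ʳ j) ≡ false
  isLeft-↑ʳ j = cong isLeft⊎ (splitAt-↑ʳ a b j)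

  leftEdges : List (Edge (a + b))
  leftEdges = filterᵇ (isLeft ∘ proj₂) (edges Gl)

  rightEdges : List (Edge (a + b))
  rightEdges = filterᵇ (not ∘ isLeft ∘ proj₂) (edges Gl)

  forwardAdj-↑ˡ↑ˡ : ∀ i i′ → forwardAdj Gl (i ↑ˡ b) (i′ ↑ˡ b) ≡ forwardAdj X i i′
  forwardAdj-↑ˡ↑ˡ i i′ rewrite toℕ-↑ˡ i b | toℕ-↑ˡ i′ b = cong (_ ∧_) (glue-join (inj₁ i) (inj₁ i′))

  forwardAdj-↑ˡ↑ʳ : ∀ i j → forwardAdj Gl (i ↑ˡ b) (a ↑ʳ j) ≡ ⌊ i ≟ x ⌋ ∧ Y y (punchIn y j)
  forwardAdj-↑ˡ↑ʳ i j rewrite toℕ-↑ˡ i b | toℕ-↑ʳ a j | <ᵇ-≡-true (≤-trans (toℕ<n i) (m≤m+n a (toℕ j))) =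
    glue-join (inj₁ i) (inj₂ j)

  forwardAdj-↑ʳ↑ˡ : ∀ j i → forwardAdj Gl (a ↑ʳ j) (i ↑ˡ b) ≡ false
  forwardAdj-↑ʳ↑ˡ j i rewrite toℕ-↑ˡ i b | toℕ-↑ʳ a j | <ᵇ-≡-false (≤-trans (<⇒≤ (toℕ<n i)) (m≤m+n a (toℕ j))) =
    refl

  forwardAdj-↑ʳ↑ʳ : ∀ j j′ → forwardAdj Gl (a ↑ʳ j) (a ↑ʳ j′) ≡ forwardAdj (removeVertex Y y) j j′
  forwardAdj-↑ʳ↑ʳ j j′ rewrite toℕ-↑ʳ a j | toℕ-↑ʳ a j′ | +-<ᵇ-+ a (toℕ j) (toℕ j′) =
    cong (_ ∧_) (glue-join (inj₂ j) (inj₂ j′))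

  embedX² : Edge a → Edge (a + b)
  embedX² = Product.map (_↑ˡ b) (_↑ˡ b)

  projY² : Edge (a + b) → Edge (suc b)
  projY² = Product.map projY projY

  punchIn² : Edge b → Edge (suc b)
  punchIn² = Product.map (punchIn y) (punchIn y)

  private
    ∧-≡-falseʳ : ∀ p {q} → q ≡ false → p ∧ q ≡ false
    ∧-≡-falseʳ p q≡false = trans (cong (p ∧_) q≡false) (∧-zeroʳ p)

    forwardAdj-↑ʳ↑ˡ-∧ : ∀ (q : Fin (a + b) → Bool) j i → forwardAdj Gl (a ↑ʳ j) (i ↑ˡ b) ∧ q (i ↑ˡ b) ≡ false
    forwardAdj-↑ʳ↑ˡ-∧ q j i = cong (_∧ q (i ↑ˡ b)) (forwardAdj-↑ʳ↑ˡ j i)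

  row-↑ˡ-left : ∀ i → filterᵇ (isLeft ∘ proj₂) (row Gl (i ↑ˡ b)) ≡ map embedX² (row X i)
  row-↑ˡ-left i = begin
    filterᵇ (isLeft ∘ proj₂) (row Gl (i ↑ˡ b))
      ≡⟨ filterᵇ-row-+ Gl isLeft (i ↑ˡ b)
           (λ i′ → trans (cong₂ _∧_ (forwardAdj-↑ˡ↑ˡ i i′) (isLeft-↑ˡ i′)) (∧-identityʳ _))
           (λ j → ∧-≡-falseʳ (forwardAdj Gl (i ↑ˡ b) (a ↑ʳ j)) (isLeft-↑ʳ j)) ⟩
    map (λ i′ → i ↑ˡ b , i′ ↑ˡ b) L ++ map (λ j → i ↑ˡ b , a ↑ʳ j) (filterᵇ (const false) (allFin b))
      ≡⟨ cong (λ r → map (λ i′ → i ↑ˡ b , i′ ↑ˡ b) L ++ map (λ j → i ↑ˡ b , a ↑ʳ j) r)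
              (filterᵇ-false (allFin b)) ⟩
    map (λ i′ → i ↑ˡ b , i′ ↑ˡ b) L ++ []   ≡⟨ ++-identityʳ _ ⟩
    map (embedX² ∘ (i ,_)) L                 ≡⟨ map-∘ L ⟩
    map embedX² (row X i)                    ∎
    where
    open ≡-Reasoning
    L = filterᵇ (forwardAdj X i) (allFin a)

  row-↑ʳ-left : ∀ j → filterᵇ (isLeft ∘ proj₂) (row Gl (a ↑ʳ j)) ≡ []
  row-↑ʳ-left j = begin
    filterᵇ (isLeft ∘ proj₂) (row Gl (a ↑ʳ j))
      ≡⟨ filterᵇ-row-+ Gl isLeft (a ↑ʳ j) (forwardAdj-↑ʳ↑ˡ-∧ isLeft j)
           (λ j′ → ∧-≡-falseʳ (forwardAdj Gl (a ↑ʳ j) (a ↑ʳ j′)) (isLeft-↑ʳ j′)) ⟩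
    map (λ i → a ↑ʳ j , i ↑ˡ b) (filterᵇ (const false) (allFin a))
      ++ map (λ j′ → a ↑ʳ j , a ↑ʳ j′) (filterᵇ (const false) (allFin b))
      ≡⟨ cong₂ (λ l r → map (λ i → a ↑ʳ j , i ↑ˡ b) l ++ map (λ j′ → a ↑ʳ j , a ↑ʳ j′) r)
               (filterᵇ-false (allFin a)) (filterᵇ-false (allFin b)) ⟩
    [] ∎
    where open ≡-Reasoning

  row-↑ˡ-right : ∀ i → map projY² (filterᵇ (not ∘ isLeft ∘ proj₂) (row Gl (i ↑ˡ b))) ≡
                        map (λ j → y , punchIn y j) (filterᵇ (λ j → ⌊ i ≟ x ⌋ ∧ Y y (punchIn y j)) (allFin b))
  row-↑ˡ-right i = begin
    map projY² (filterᵇ (not ∘ isLeft ∘ proj₂) (row Gl (i ↑ˡ b)))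
      ≡⟨ cong (map projY²) (filterᵇ-row-+ Gl (not ∘ isLeft) (i ↑ˡ b)
           (λ i′ → ∧-≡-falseʳ (forwardAdj Gl (i ↑ˡ b) (i′ ↑ˡ b)) (cong not (isLeft-↑ˡ i′)))
           (λ j → trans (cong₂ _∧_ (forwardAdj-↑ˡ↑ʳ i j) (cong not (isLeft-↑ʳ j))) (∧-identityʳ _))) ⟩
    map projY² (map (λ i′ → i ↑ˡ b , i′ ↑ˡ b) (filterᵇ (const false) (allFin a)) ++ map (λ j → i ↑ˡ b , a ↑ʳ j) R)
      ≡⟨ cong (λ l → map projY² (map (λ i′ → i ↑ˡ b , i′ ↑ˡ b) l ++ map (λ j → i ↑ˡ b , a ↑ʳ j) R))
              (filterᵇ-false (allFin a)) ⟩
    map projY² (map (λ j → i ↑ˡ b , a ↑ʳ j) R)      ≡⟨ map-∘ R ⟨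
    map (λ j → projY (i ↑ˡ b) , projY (a ↑ʳ j)) R
      ≡⟨ map-cong (λ j → cong₂ _,_ (projY-join (inj₁ i)) (projY-join (inj₂ j))) R ⟩
    map (λ j → y , punchIn y j) R                   ∎
    where
    open ≡-Reasoning
    R = filterᵇ (λ j → ⌊ i ≟ x ⌋ ∧ Y y (punchIn y j)) (allFin b)

  row-↑ʳ-right : ∀ j → map projY² (filterᵇ (not ∘ isLeft ∘ proj₂) (row Gl (a ↑ʳ j))) ≡
                        map punchIn² (row (removeVertex Y y) j)
  row-↑ʳ-right j = begin
    map projY² (filterᵇ (not ∘ isLeft ∘ proj₂) (row Gl (a ↑ʳ j)))
      ≡⟨ cong (map projY²) (filterᵇ-row-+ Gl (not ∘ isLeft) (a ↑ʳ j) (forwardAdj-↑ʳ↑ˡ-∧ (not ∘ isLeft) j)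
           (λ j′ → trans (cong₂ _∧_ (forwardAdj-↑ʳ↑ʳ j j′) (cong not (isLeft-↑ʳ j′))) (∧-identityʳ _))) ⟩
    map projY² (map (λ i → a ↑ʳ j , i ↑ˡ b) (filterᵇ (const false) (allFin a)) ++ map (λ j′ → a ↑ʳ j , a ↑ʳ j′) R)
      ≡⟨ cong (λ l → map projY² (map (λ i → a ↑ʳ j , i ↑ˡ b) l ++ map (λ j′ → a ↑ʳ j , a ↑ʳ j′) R))
              (filterᵇ-false (allFin a)) ⟩
    map projY² (map (λ j′ → a ↑ʳ j , a ↑ʳ j′) R)          ≡⟨ map-∘ R ⟨
    map (λ j′ → projY (a ↑ʳ j) , projY (a ↑ʳ j′)) R
      ≡⟨ map-cong (λ j′ → cong₂ _,_ (projY-join (inj₂ j)) (projY-join (inj₂ j′))) R ⟩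
    map (punchIn² ∘ (j ,_)) R                             ≡⟨ map-∘ R ⟩
    map punchIn² (row (removeVertex Y y) j)               ∎
    where
    open ≡-Reasoning
    R = filterᵇ (forwardAdj (removeVertex Y y) j) (allFin b)

  leftEdges-glue : leftEdges ≡ map embedX² (edges X)
  leftEdges-glue = begin
    filterᵇ (isLeft ∘ proj₂) (concatMap (row Gl) (allFin (a + b)))
      ≡⟨ filterᵇ-concatMap _ (row Gl) (allFin (a + b)) ⟩
    concatMap F (allFin (a + b))
      ≡⟨ concatMap-allFin-+ {a} {b} F ⟩
    concatMap (F ∘ (_↑ˡ b)) (allFin a) ++ concatMap (F ∘ (a ↑ʳ_)) (allFin b)
      ≡⟨ cong₂ _++_ (concatMap-cong row-↑ˡ-left (allFin a)) (concatMap-[] (F ∘ (a ↑ʳ_)) row-↑ʳ-left (allFin b)) ⟩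
    concatMap (map embedX² ∘ row X) (allFin a) ++ []                          ≡⟨ ++-identityʳ _ ⟩
    concatMap (map embedX² ∘ row X) (allFin a)
      ≡⟨ map-concatMap embedX² (row X) (allFin a) ⟨
    map embedX² (edges X)                                                     ∎
    where
    open ≡-Reasoning
    F = filterᵇ (isLeft ∘ proj₂) ∘ row Gl

  length-leftEdges : length leftEdges ≡ numEdges X
  length-leftEdges = trans (cong length leftEdges-glue) (length-map embedX² (edges X))

  rightEdges-image : map projY² rightEdges ≡ rootedEdges Y y
  rightEdges-image = begin
    map projY² (filterᵇ (not ∘ isLeft ∘ proj₂) (concatMap (row Gl) (allFin (a + b))))
      ≡⟨ cong (map projY²) (filterᵇ-concatMap _ (row Gl) (allFin (a + b))) ⟩
    map projY² (concatMap F (allFin (a + b)))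
      ≡⟨ map-concatMap projY² F (allFin (a + b)) ⟩
    concatMap F′ (allFin (a + b))
      ≡⟨ concatMap-allFin-+ {a} {b} F′ ⟩
    concatMap (F′ ∘ (_↑ˡ b)) (allFin a) ++ concatMap (F′ ∘ (a ↑ʳ_)) (allFin b)
      ≡⟨ cong₂ _++_ (concatMap-allFin-single (F′ ∘ (_↑ˡ b)) x no-spokes) (concatMap-cong row-↑ʳ-right (allFin b)) ⟩
    F′ (x ↑ˡ b) ++ concatMap (map punchIn² ∘ row Y⁻) (allFin b)
      ≡⟨ cong₂ _++_ (trans (row-↑ˡ-right x) (cong (map _) (filterᵇ-cong (λ j → cong (_∧ _) ⌊x≟x⌋) (allFin b))))
                    (sym (map-concatMap punchIn² (row Y⁻) (allFin b))) ⟩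
    spokes Y y ++ map punchIn² (edges Y⁻)                                     ∎
    where
    open ≡-Reasoning
    Y⁻ = removeVertex Y y
    F  = filterᵇ (not ∘ isLeft ∘ proj₂) ∘ row Gl
    F′ = map projY² ∘ F
    no-spokes : ∀ i → i ≢ x → F′ (i ↑ˡ b) ≡ []
    no-spokes i i≢x = trans (row-↑ˡ-right i) (cong (map _) (filterᵇ-none _ (λ j → cong (_∧ _) ⌊i≟x⌋) (allFin b)))
      where
      ⌊i≟x⌋ : ⌊ i ≟ x ⌋ ≡ false
      ⌊i≟x⌋ = trans (isYes≗does (i ≟ x)) (dec-false (i ≟ x) i≢x)

  length-rightEdges : IsSimple Y → length rightEdges ≡ numEdges Y
  length-rightEdges SY = begin
    length rightEdges               ≡⟨ length-map projY² rightEdges ⟨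
    length (map projY² rightEdges)  ≡⟨ cong length rightEdges-image ⟩
    length (rootedEdges Y y)        ≡⟨ length-rootedEdges Y y SY ⟩
    numEdges Y                      ∎
    where open ≡-Reasoning

  AtX : Edge (a + b) → Set
  AtX (s , t) = projX s ≡ x × projX t ≡ x

  rightEdges-at-x : All AtX rightEdges
  rightEdges-at-x = All.map (λ {(s , t)} (adj , right) → at-x (splitAt a s) (splitAt a t) (trans (sym (glue-splitAt s t)) adj) right)
    (All.zip (filter⁺ right? (All-edges Gl) , all-filter right? (edges Gl)))
    where
    right? = T? ∘ (not ∘ isLeft ∘ proj₂)
    at-x : ∀ σ τ → adj⊎ σ τ ≡ true → T (not (isLeft⊎ τ)) → projX⊎ σ ≡ x × projX⊎ τ ≡ x
    at-x (inj₁ i) (inj₂ j) adj _ with i ≟ x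
    ... | yes i≡x = i≡x , refl
    at-x (inj₂ _) (inj₂ _) _ _ = refl , refl

  module _ (SY : IsSimple Y) (X-conn : Connected X) (Y-conn : Connected Y) where

    distSum⊎ : Fin a ⊎ Fin b → Fin a ⊎ Fin b → ℕ
    distSum⊎ σ τ = dist X (projX⊎ σ) (projX⊎ τ) + dist Y (projY⊎ σ) (projY⊎ τ)

    distSum : Fin (a + b) → Fin (a + b) → ℕ
    distSum s t = distSum⊎ (splitAt a s) (splitAt a t)

    private
      walkX : ∀ i i′ → WalkWithin Gl (dist X i i′) (i ↑ˡ b) (i′ ↑ˡ b)
      walkX i i′ = mapWithin (_↑ˡ b) inclX-hom (shortestWalk X (X-conn i i′))

      walkY : ∀ w w′ → WalkWithin Gl (dist Y w w′) (inclY w) (inclY w′)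
      walkY w w′ = mapWithin inclY (inclY-hom (IsSimple.irreflexive SY)) (shortestWalk Y (Y-conn w w′))

      cast : ∀ {d s s′ t t′} → s ≡ s′ → t ≡ t′ → WalkWithin Gl d s t → WalkWithin Gl d s′ t′
      cast = subst₂ (WalkWithin Gl _)

      walkWithin⊎ : ∀ σ τ → WalkWithin Gl (distSum⊎ σ τ) (join a b σ) (join a b τ)
      walkWithin⊎ (inj₁ i) (inj₁ i′) = weakenʷ (m≤m+n _ _) (walkX i i′)
      walkWithin⊎ (inj₁ i) (inj₂ j)  = walkX i x ⊕ʷ cast inclY-y (inclY-punchIn j) (walkY y (punchIn y j))
      walkWithin⊎ (inj₂ j) (inj₁ i)  = weakenʷ (≤-reflexive (+-comm (dist Y (punchIn y j) y) (dist X x i)))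
        (cast (inclY-punchIn j) inclY-y (walkY (punchIn y j) y) ⊕ʷ walkX x i)
      walkWithin⊎ (inj₂ j) (inj₂ j′) = weakenʷ (m≤n+m _ _)
        (cast (inclY-punchIn j) (inclY-punchIn j′) (walkY (punchIn y j) (punchIn y j′)))

    walkWithin : ∀ s t → WalkWithin Gl (distSum s t) s t
    walkWithin s t = subst₂ (WalkWithin Gl (distSum s t)) (join-splitAt a b s) (join-splitAt a b t)
                            (walkWithin⊎ (splitAt a s) (splitAt a t))

    glue-connected : Connected Gl
    glue-connected s t = proj₁ (walkWithin s t)

    dist-glue : ∀ s t → dist Gl s t ≡ distSum s t
    dist-glue s t = ≤-antisym (dist-≤ Gl (walkWithin s t)) distSum-≤-dist
      where
      distSum-≤-dist : distSum s t ≤ dist Gl s t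
      distSum-≤-dist with w , |w|≤d ← shortestWalk Gl (glue-connected s t)
                        with u , v , |u|+|v|≤|w| ← projectWalk w =
        ≤-trans (+-mono-≤ (dist-≤-len X u) (dist-≤-len Y v)) (≤-trans |u|+|v|≤|w| |w|≤d)

    dist-↑ˡ : ∀ i t → dist Gl (i ↑ˡ b) t ≡ dist X i (projX t) + dist Y y (projY t)
    dist-↑ˡ i t = trans (dist-glue (i ↑ˡ b) t)
      (cong₂ (λ p q → dist X p (projX t) + dist Y q (projY t)) (projX-join (inj₁ i)) (projY-join (inj₁ i)))

    dist-↑ˡ-↑ˡ : ∀ i i′ → dist Gl (i ↑ˡ b) (i′ ↑ˡ b) ≡ dist X i i′
    dist-↑ˡ-↑ˡ i i′ = begin
      dist Gl (i ↑ˡ b) (i′ ↑ˡ b)                                  ≡⟨ dist-↑ˡ i (i′ ↑ˡ b) ⟩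
      dist X i (projX (i′ ↑ˡ b)) + dist Y y (projY (i′ ↑ˡ b))
        ≡⟨ cong₂ (λ p q → dist X i p + dist Y y q) (projX-join (inj₁ i′)) (projY-join (inj₁ i′)) ⟩
      dist X i i′ + dist Y y y                                    ≡⟨ cong (dist X i i′ +_) (dist-refl Y y) ⟩
      dist X i i′ + 0                                             ≡⟨ +-identityʳ _ ⟩
      dist X i i′                                                 ∎
      where open ≡-Reasoning

    dist-at-x : ∀ {s t} → projX s ≡ x → projX t ≡ x → dist Gl s t ≡ dist Y (projY s) (projY t)
    dist-at-x {s} {t} s-at-x t-at-x = begin
      dist Gl s t                                            ≡⟨ dist-glue s t ⟩
      dist X (projX s) (projX t) + dist Y (projY s) (projY t) ≡⟨ cong₂ (λ p q → dist X p q + dY) s-at-x t-at-x ⟩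
      dist X x x + dist Y (projY s) (projY t)                 ≡⟨ cong (_+ dY) (dist-refl X x) ⟩
      dist Y (projY s) (projY t)                              ∎
      where
      open ≡-Reasoning
      dY = dist Y (projY s) (projY t)

    module _ (SX : IsSimple X) where

      dist-sym-Gl : ∀ s t → dist Gl s t ≡ dist Gl t s
      dist-sym-Gl = dist-sym Gl (glue-isSimple SX SY) glue-connected

      edgeDist-embedX² : ∀ e f → edgeDist Gl (embedX² e) (embedX² f) ≡ edgeDist X e f
      edgeDist-embedX² (p₁ , p₂) (q₁ , q₂) = cong suc (cong₂ _⊓_
        (cong₂ _⊓_ (dist-↑ˡ-↑ˡ p₁ q₁) (dist-↑ˡ-↑ˡ p₁ q₂)) (cong₂ _⊓_ (dist-↑ˡ-↑ˡ p₂ q₁) (dist-↑ˡ-↑ˡ p₂ q₂)))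

      edgeDist-at-x : ∀ {e f} → AtX e → AtX f → edgeDist Gl e f ≡ edgeDist Y (projY² e) (projY² f)
      edgeDist-at-x (s₁-at-x , s₂-at-x) (t₁-at-x , t₂-at-x) = cong suc (cong₂ _⊓_
        (cong₂ _⊓_ (dist-at-x s₁-at-x t₁-at-x) (dist-at-x s₁-at-x t₂-at-x))
        (cong₂ _⊓_ (dist-at-x s₂-at-x t₁-at-x) (dist-at-x s₂-at-x t₂-at-x)))

      edgeDist-across : ∀ e {f} → AtX f →
                        edgeDist Gl (embedX² e) f ≡ suc (distToEdge X x e + distToEdge Y y (projY² f))
      edgeDist-across (p₁ , p₂) {t₁ , t₂} (t₁-at-x , t₂-at-x) = cong suc (begin
        (dist Gl (p₁ ↑ˡ b) t₁ ⊓ dist Gl (p₁ ↑ˡ b) t₂) ⊓ (dist Gl (p₂ ↑ˡ b) t₁ ⊓ dist Gl (p₂ ↑ˡ b) t₂)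
          ≡⟨ cong₂ _⊓_ (cong₂ _⊓_ (across p₁ t₁-at-x) (across p₁ t₂-at-x))
                       (cong₂ _⊓_ (across p₂ t₁-at-x) (across p₂ t₂-at-x)) ⟩
        ((dist X x p₁ + β₁) ⊓ (dist X x p₁ + β₂)) ⊓ ((dist X x p₂ + β₁) ⊓ (dist X x p₂ + β₂))
          ≡⟨ +-⊓-+ (dist X x p₁) (dist X x p₂) β₁ β₂ ⟩
        distToEdge X x (p₁ , p₂) + β₁ ⊓ β₂ ∎)
        where
        open ≡-Reasoning
        β₁ = dist Y y (projY t₁)
        β₂ = dist Y y (projY t₂)
        across : ∀ p {t} → projX t ≡ x → dist Gl (p ↑ˡ b) t ≡ dist X x p + dist Y y (projY t)
        across p {t} t-at-x = trans (dist-↑ˡ p t)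
          (cong (_+ dist Y y (projY t)) (trans (cong (dist X p) t-at-x) (dist-sym X SX X-conn p x)))

      We-glue : We Gl ≡ We X + pairSum (edgeDist Y) (rootedEdges Y y)
                             + numEdges X * sumMap (suc ∘ distToEdge Y y) (rootedEdges Y y)
                             + numEdges Y * totalDistToEdges X x
      We-glue = begin
        We Gl
          ≡⟨ pairSum-partition (edgeDist Gl) (edgeDist-sym Gl dist-sym-Gl) (isLeft ∘ proj₂) (edges Gl) ⟩
        pairSum (edgeDist Gl) leftEdges + pairSum (edgeDist Gl) rightEdges
          + crossSum (edgeDist Gl) leftEdges rightEdges
          ≡⟨ cong (λ L → pairSum (edgeDist Gl) L + pairSum (edgeDist Gl) rightEdges + crossSum (edgeDist Gl) L rightEdges)
                  leftEdges-glue ⟩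
        pairSum (edgeDist Gl) (map embedX² (edges X)) + pairSum (edgeDist Gl) rightEdges
          + crossSum (edgeDist Gl) (map embedX² (edges X)) rightEdges
          ≡⟨ cong₂ _+_ (cong₂ _+_ pairs-in-X pairs-in-Y) pairs-across ⟩
        We X + pairSum (edgeDist Y) R + (numEdges Y * D + numEdges X * K)
          ≡⟨ regroup (We X) (pairSum (edgeDist Y) R) (numEdges Y * D) (numEdges X * K) ⟩
        We X + pairSum (edgeDist Y) R + numEdges X * K + numEdges Y * D ∎
        where
        open ≡-Reasoning
        R = rootedEdges Y y
        K = sumMap (suc ∘ distToEdge Y y) R
        D = totalDistToEdges X x

        pairs-in-X : pairSum (edgeDist Gl) (map embedX² (edges X)) ≡ We X
        pairs-in-X = sym (pairSum-map-local (edgeDist X) (edgeDist Gl) embedX²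
                            (λ {e} {f} _ _ → sym (edgeDist-embedX² e f)) (All.universal (λ _ → tt) (edges X)))

        pairs-in-Y : pairSum (edgeDist Gl) rightEdges ≡ pairSum (edgeDist Y) R
        pairs-in-Y = trans (pairSum-map-local (edgeDist Gl) (edgeDist Y) projY² edgeDist-at-x rightEdges-at-x)
                           (cong (pairSum (edgeDist Y)) rightEdges-image)

        across-from : ∀ e → sumMap (edgeDist Gl (embedX² e)) rightEdges ≡ numEdges Y * distToEdge X x e + K
        across-from e = begin
          sumMap (edgeDist Gl (embedX² e)) rightEdges
            ≡⟨ sumMap-cong-local (edgeDist-across e) rightEdges-at-x ⟩
          sumMap ((λ f → suc (distToEdge X x e + distToEdge Y y f)) ∘ projY²) rightEdges
            ≡⟨ sumMap-map _ projY² rightEdges ⟨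
          sumMap (λ f → suc (distToEdge X x e + distToEdge Y y f)) (map projY² rightEdges)
            ≡⟨ cong (sumMap _) rightEdges-image ⟩
          sumMap (λ f → suc (distToEdge X x e + distToEdge Y y f)) R
            ≡⟨ sumMap-cong (λ f → sym (+-suc (distToEdge X x e) (distToEdge Y y f))) R ⟩
          sumMap (λ f → distToEdge X x e + suc (distToEdge Y y f)) R
            ≡⟨ sumMap-+ˡ-const (distToEdge X x e) (suc ∘ distToEdge Y y) R ⟩
          length R * distToEdge X x e + K
            ≡⟨ cong (λ m → m * distToEdge X x e + K) (length-rootedEdges Y y SY) ⟩
          numEdges Y * distToEdge X x e + K ∎

        pairs-across : crossSum (edgeDist Gl) (map embedX² (edges X)) rightEdges ≡ numEdges Y * D + numEdges X * K
        pairs-across = begin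
          crossSum (edgeDist Gl) (map embedX² (edges X)) rightEdges
            ≡⟨ sumMap-map _ embedX² (edges X) ⟩
          sumMap (λ e → sumMap (edgeDist Gl (embedX² e)) rightEdges) (edges X)
            ≡⟨ sumMap-cong across-from (edges X) ⟩
          sumMap (λ e → numEdges Y * distToEdge X x e + K) (edges X)
            ≡⟨ sumMap-+ (λ e → numEdges Y * distToEdge X x e) (λ _ → K) (edges X) ⟩
          sumMap (λ e → numEdges Y * distToEdge X x e) (edges X) + sumMap (λ _ → K) (edges X)
            ≡⟨ cong₂ _+_ (sumMap-*ˡ (numEdges Y) (distToEdge X x) (edges X)) (sumMap-const K (edges X)) ⟩
          numEdges Y * D + numEdges X * K ∎

        regroup : ∀ w p c k → w + p + (c + k) ≡ w + p + k + c
        regroup = solve-∀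

      totalDistToEdges-↑ˡ-≤ : ∀ v → numEdges X ≤ numEdges Y →
                              totalDistToEdges Gl (x ↑ˡ b) ≤ totalDistToEdges Gl (v ↑ˡ b)
      totalDistToEdges-↑ˡ-≤ v mX≤mY = begin
        totalDistToEdges Gl (x ↑ˡ b)
          ≡⟨ sumMap-partition (δ x) (isLeft ∘ proj₂) (edges Gl) ⟩
        sumMap (δ x) leftEdges + sumMap (δ x) rightEdges
          ≤⟨ +-monoˡ-≤ _ (sumMap-mono-≤ (distToEdge-shift-≤ Gl x-to-v) leftEdges) ⟩
        sumMap (λ e → Δ + δ v e) leftEdges + sumMap (δ x) rightEdges
          ≡⟨ cong (_+ sumMap (δ x) rightEdges) (sumMap-+ˡ-const Δ (δ v) leftEdges) ⟩
        length leftEdges * Δ + sumMap (δ v) leftEdges + sumMap (δ x) rightEdges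
          ≤⟨ +-monoˡ-≤ _ (+-monoˡ-≤ _ (*-monoˡ-≤ Δ (≤-trans (≤-reflexive length-leftEdges)
                                                  (≤-trans mX≤mY (≤-reflexive (sym (length-rightEdges SY))))))) ⟩
        length rightEdges * Δ + sumMap (δ v) leftEdges + sumMap (δ x) rightEdges
          ≡⟨ xy∙z≈y∙xz (length rightEdges * Δ) (sumMap (δ v) leftEdges) (sumMap (δ x) rightEdges) ⟩
        sumMap (δ v) leftEdges + (length rightEdges * Δ + sumMap (δ x) rightEdges)
          ≡⟨ cong (sumMap (δ v) leftEdges +_) (sumMap-+ˡ-const Δ (δ x) rightEdges) ⟨
        sumMap (δ v) leftEdges + sumMap (λ e → Δ + δ x e) rightEdges
          ≡⟨ cong (sumMap (δ v) leftEdges +_) (sumMap-cong-local v-to-x rightEdges-at-x) ⟨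
        sumMap (δ v) leftEdges + sumMap (δ v) rightEdges
          ≡⟨ sumMap-partition (δ v) (isLeft ∘ proj₂) (edges Gl) ⟨
        totalDistToEdges Gl (v ↑ˡ b)                       ∎
        where
        open ≤-Reasoning
        δ : Fin a → Edge (a + b) → ℕ
        δ c = distToEdge Gl (c ↑ˡ b)
        Δ = dist X x v

        x-to-v : ∀ s → dist Gl (x ↑ˡ b) s ≤ Δ + dist Gl (v ↑ˡ b) s
        x-to-v s = begin
          dist Gl (x ↑ˡ b) s                              ≡⟨ dist-↑ˡ x s ⟩
          dist X x (projX s) + dist Y y (projY s)
            ≤⟨ +-monoˡ-≤ _ (dist-triangle X X-conn x v (projX s)) ⟩
          Δ + dist X v (projX s) + dist Y y (projY s)     ≡⟨ +-assoc Δ _ _ ⟩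
          Δ + (dist X v (projX s) + dist Y y (projY s))   ≡⟨ cong (Δ +_) (dist-↑ˡ v s) ⟨
          Δ + dist Gl (v ↑ˡ b) s                          ∎

        v-to-x-at : ∀ {s} → projX s ≡ x → dist Gl (v ↑ˡ b) s ≡ Δ + dist Gl (x ↑ˡ b) s
        v-to-x-at {s} s-at-x = begin-equality
          dist Gl (v ↑ˡ b) s                        ≡⟨ dist-↑ˡ v s ⟩
          dist X v (projX s) + dist Y y (projY s)   ≡⟨ cong (λ p → dist X v p + dist Y y (projY s)) s-at-x ⟩
          dist X v x + dist Y y (projY s)
            ≡⟨ cong (_+ dist Y y (projY s)) (dist-sym X SX X-conn v x) ⟩
          Δ + dist Y y (projY s)
            ≡⟨ cong (λ d → Δ + (d + dist Y y (projY s))) (dist-refl X x) ⟨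
          Δ + (dist X x x + dist Y y (projY s))
            ≡⟨ cong (λ p → Δ + (dist X x p + dist Y y (projY s))) s-at-x ⟨
          Δ + (dist X x (projX s) + dist Y y (projY s)) ≡⟨ cong (Δ +_) (dist-↑ˡ x s) ⟨
          Δ + dist Gl (x ↑ˡ b) s                    ∎

        v-to-x : ∀ {e} → AtX e → δ v e ≡ Δ + δ x e
        v-to-x (s-at-x , t-at-x) = distToEdge-shift-≡ Gl (v-to-x-at s-at-x) (v-to-x-at t-at-x)

lemma9 : (n₁ k₂ k₃ : ℕ)
    (G₁ : Graph n₁) (G₂ : Graph (suc k₂)) (G₃ : Graph (suc k₃))
    → IsSimple G₁ → IsSimple G₂ → IsSimple G₃
    → Connected G₁ → Connected G₂ → Connected G₃
    → 2 ≤ n₁ → 2 ≤ suc k₂ → 2 ≤ suc k₃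
    → (u₁ : Fin n₁) (u₂ : Fin (suc k₂)) (u₃ : Fin (suc k₃))
    → (v : Fin n₁)
    → (∀ w → dist G₁ u₁ w ≤ dist G₁ u₁ v)
    → numEdges G₁ ≤ numEdges G₂
    → We (glue (glue G₁ u₁ G₂ u₂) (embL k₂ u₁) G₃ u₃)
    ≤ We (glue (glue G₁ u₁ G₂ u₂) (embL k₂ v) G₃ u₃)
lemma9 n₁ k₂ k₃ G₁ G₂ G₃ S₁ S₂ S₃ C₁ C₂ C₃ _ _ _ u₁ u₂ u₃ v _ m₁≤m₂ = begin
  We (glue H (u₁ ↑ˡ k₂) G₃ u₃)  ≡⟨ We-glue-at (u₁ ↑ˡ k₂) ⟩
  K + m₃ * D (u₁ ↑ˡ k₂)         ≤⟨ +-monoʳ-≤ K (*-monoʳ-≤ m₃ D-u≤D-v) ⟩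
  K + m₃ * D (v ↑ˡ k₂)          ≡⟨ We-glue-at (v ↑ˡ k₂) ⟨
  We (glue H (v ↑ˡ k₂) G₃ u₃)   ∎
  where
  open ≤-Reasoning
  H = glue G₁ u₁ G₂ u₂
  S-H = Glued.glue-isSimple G₁ u₁ G₂ u₂ S₁ S₂
  C-H = Glued.glue-connected G₁ u₁ G₂ u₂ S₂ C₁ C₂
  m₃ = numEdges G₃
  D = totalDistToEdges H
  R = rootedEdges G₃ u₃
  K = We H + pairSum (edgeDist G₃) R + numEdges H * sumMap (suc ∘ distToEdge G₃ u₃) R

  We-glue-at : ∀ c → We (glue H c G₃ u₃) ≡ K + m₃ * D c
  We-glue-at c = Glued.We-glue H c G₃ u₃ S₃ C-H C₃ S-H

  D-u≤D-v : D (u₁ ↑ˡ k₂) ≤ D (v ↑ˡ k₂)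
  D-u≤D-v = Glued.totalDistToEdges-↑ˡ-≤ G₁ u₁ G₂ u₂ S₂ C₁ C₂ S₁ v m₁≤m₂
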